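{- Let $\mathcal M_1=(W_1,\preccurlyeq_1,S_1,V_1)$ and $\mathcal M_2=(W_2,\preccurlyeq_2,S_2,V_2)$ be models and $\mathcal Z_n\subseteq\cdots\subseteq\mathcal Z_0$ a bounded $\Box$-bisimulation between them. Then for all $(w_1,w_2)\in W_1\times W_2$ and $i\le n$, if $w_1\mathcal Z_iw_2$, then for every $\varphi\in\mathcal L_\Box$ with $|\varphi|\le i$, $\mathcal M_1,w_1\models\varphi$ iff $\mathcal M_2,w_2\models\varphi$.
   Context: A model is $(W,\preccurlyeq,S,V)$ with $\preccurlyeq$ a partial order on $W\ne\emptyset$, $S:W\to W$ satisfying $w\preccurlyeq v\Rightarrow S(w)\preccurlyeq S(v)$, and $V$ assigning each world a set of propositional variables, monotone along $\preccurlyeq$. $\mathcal L_\Box$ is the set of formulas built from variables and $\bot$ using $\wedge,\vee,\to,\bigcirc,\Box$. Satisfaction: $w\models p$ iff $p\in V(w)$; $w\not\models\bot$; $\wedge,\vee$ classical; $w\models\varphi\to\psi$ iff for all $v\succcurlyeq w$, $v\models\varphi$ implies $v\models\psi$; $w\models\bigcirc\varphi$ iff $S(w)\models\varphi$; $w\models\Box\varphi$ iff $S^k(w)\models\varphi$ for all $k\ge0$. Length: $|p|=|\bot|=0$; $|\varphi\odot\psi|=1+|\varphi|+|\psi|$ for binary $\odot$; $|\odot\psi|=1+|\psi|$ for unary $\odot$. For $n>0$, a bounded $\bigcirc$-bisimulation is a sequence $\mathcal Z_n\subseteq\cdots\subseteq\mathcal Z_0\subseteq W_1\times W_2$ such that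 for all $0\le i<n$: if $w_1\mathcal Z_iw_2$ then $w_1,w_2$ satisfy the same variables; if $w_1\mathcal Z_{i+1}w_2$ then every $v_1\succcurlyeq w_1$ has some $v_2\succcurlyeq w_2$ with $v_1\mathcal Z_iv_2$, every $v_2\succcurlyeq w_2$ has some $v_1\succcurlyeq w_1$ with $v_1\mathcal Z_iv_2$, and $S_1(w_1)\mathcal Z_iS_2(w_2)$. It is a bounded $\Box$-bisimulation if moreover, for all $0\le i<n$ and $w_1\mathcal Z_{i+1}w_2$: (Forth $\Box$) for every $k_2\ge0$ there are $k_1\ge0$ and $(v_1,v_2)\in W_1\times W_2$ with $S_2^{k_2}(w_2)\succcurlyeq v_2$, $v_1\succcurlyeq S_1^{k_1}(w_1)$ and $v_1\mathcal Z_iv_2$; (Back $\Box$) for every $k_1\ge0$ there are $k_2\ge0$ and $(v_1,v_2)$ with $S_1^{k_1}(w_1)\succcurlyeq v_1$, $v_2\succcurlyeq S_2^{k_2}(w_2)$ and $v_1\mathcal Z_iv_2$. -}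

module Defs where

open import Level using (Level; _⊔_; suc)
open import Data.Nat using (ℕ; zero; _<_; _≤_) renaming (suc to sucℕ; _+_ to _+ℕ_)
open import Data.Product using (Σ; _×_; _,_; ∃)
open import Data.Sum using (_⊎_)
open import Data.Empty using (⊥)
open import Relation.Binary.Structures using (IsPartialOrder)
open import Relation.Binary.PropositionalEquality using (_≡_)

Var : Set
Var = ℕ

iter : ∀ {a} {A : Set a} → (A → A) → ℕ → A → A
iter f zero x = x
iter f (sucℕ k) x = f (iter f k x)

record Model (a ℓ : Level) : Set (suc (a ⊔ ℓ)) where
  field
    W         : Set a
    inhabited : W
    _≼_       : W → W → Set ℓ
    isPO      : IsPartialOrder _≡_ _≼_
    S         : W → W
    S-mono    : ∀ {w v} → w ≼ v → S w ≼ S v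
    V         : W → Var → Set ℓ
    V-mono    : ∀ {w v} → w ≼ v → ∀ p → V w p → V v p

data Form : Set where
  var  : Var → Form
  ⊥'   : Form
  _∧'_ : Form → Form → Form
  _∨'_ : Form → Form → Form
  _⇒'_ : Form → Form → Form
  ◯    : Form → Form
  □    : Form → Form

len : Form → ℕ
len (var p)  = 0
len ⊥'       = 0
len (φ ∧' ψ) = sucℕ (len φ +ℕ len ψ)
len (φ ∨' ψ) = sucℕ (len φ +ℕ len ψ)
len (φ ⇒' ψ) = sucℕ (len φ +ℕ len ψ)
len (◯ φ)    = sucℕ (len φ)
len (□ φ)    = sucℕ (len φ)

module _ {a ℓ} (M : Model a ℓ) where
  open Model M
  _⊨_ : W → Form → Set (a ⊔ ℓ)
  w ⊨ var p    = Level.Lift a (V w p)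
  w ⊨ ⊥'       = Level.Lift (a ⊔ ℓ) ⊥
  w ⊨ (φ ∧' ψ) = (w ⊨ φ) × (w ⊨ ψ)
  w ⊨ (φ ∨' ψ) = (w ⊨ φ) ⊎ (w ⊨ ψ)
  w ⊨ (φ ⇒' ψ) = ∀ v → w ≼ v → v ⊨ φ → v ⊨ ψ
  w ⊨ ◯ φ      = S w ⊨ φ
  w ⊨ □ φ      = ∀ k → iter S k w ⊨ φ

record IsBoundedBoxBisim {a₁ ℓ₁ a₂ ℓ₂ z} (M₁ : Model a₁ ℓ₁) (M₂ : Model a₂ ℓ₂)
    (n : ℕ) (Z : ℕ → Model.W M₁ → Model.W M₂ → Set z)
    : Set (a₁ ⊔ ℓ₁ ⊔ a₂ ⊔ ℓ₂ ⊔ z) where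
  open Model M₁ renaming (W to W₁; _≼_ to _≼₁_; S to S₁; V to V₁)
  open Model M₂ renaming (W to W₂; _≼_ to _≼₂_; S to S₂; V to V₂)
  field
    n-pos    : 0 < n
    nested   : ∀ i → i < n → ∀ {w₁ w₂} → Z (sucℕ i) w₁ w₂ → Z i w₁ w₂
    atoms    : ∀ i → i < n → ∀ {w₁ w₂} → Z i w₁ w₂ →
               ∀ p → (V₁ w₁ p → V₂ w₂ p) × (V₂ w₂ p → V₁ w₁ p)
    forth≼   : ∀ i → i < n → ∀ {w₁ w₂} → Z (sucℕ i) w₁ w₂ →
               ∀ v₁ → w₁ ≼₁ v₁ → Σ W₂ λ v₂ → (w₂ ≼₂ v₂) × Z i v₁ v₂
    back≼    : ∀ i → i < n → ∀ {w₁ w₂} → Z (sucℕ i) w₁ w₂ →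
               ∀ v₂ → w₂ ≼₂ v₂ → Σ W₁ λ v₁ → (w₁ ≼₁ v₁) × Z i v₁ v₂
    succ     : ∀ i → i < n → ∀ {w₁ w₂} → Z (sucℕ i) w₁ w₂ → Z i (S₁ w₁) (S₂ w₂)
    forth□   : ∀ i → i < n → ∀ {w₁ w₂} → Z (sucℕ i) w₁ w₂ →
               ∀ k₂ → Σ ℕ λ k₁ → Σ W₁ λ v₁ → Σ W₂ λ v₂ →
                 (v₂ ≼₂ iter S₂ k₂ w₂) × (iter S₁ k₁ w₁ ≼₁ v₁) × Z i v₁ v₂
    back□    : ∀ i → i < n → ∀ {w₁ w₂} → Z (sucℕ i) w₁ w₂ →
               ∀ k₁ → Σ ℕ λ k₂ → Σ W₁ λ v₁ → Σ W₂ λ v₂ →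
                 (v₁ ≼₁ iter S₁ k₁ w₁) × (iter S₂ k₂ w₂ ≼₂ v₂) × Z i v₁ v₂

module Submission where

-- Call a formula φ "invariant at level i" when any two worlds related by
-- Z_i agree on φ.  We show by structural recursion on φ that φ is invariant
-- at every level i ≤ n with |φ| ≤ i:
--   * atoms and ⊥ are invariant at every level i ≤ n, since Z_i ⊆ Z_0
--     and Z_0-related worlds satisfy the same variables;
--   * ∧ and ∨ preserve invariance at a fixed level (no bisimulation needed);
--   * ⇒, ◯ and □ lift invariance from level j to level j+1, using the
--     ≼-back-and-forth clauses, the successor clause, and the □-clauses.
-- The □ case only produces worlds *below* an iterate S^k(w) and *above*
-- another, so it needs persistence: satisfaction is upward closed along ≼.

open import Defs
open import Level using (Level; _⊔_; lift; lower)
open import Data.Nat using (ℕ; _≤_; _<_; zero; s≤s) renaming (suc to sucℕ; _+_ to _+ℕ_)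
open import Data.Nat.Properties using (≤-trans; <⇒≤; m≤m+n; m≤n+m)
open import Data.Product using (_×_; _,_; proj₁; proj₂)
open import Data.Sum using (inj₁; inj₂)
open import Relation.Binary.Structures using (IsPartialOrder; IsPreorder)

module Persistence {a ℓ} (M : Model a ℓ) where
  open Model M

  ≼-trans : ∀ {x y z} → x ≼ y → y ≼ z → x ≼ z
  ≼-trans = IsPreorder.trans (IsPartialOrder.isPreorder isPO)

  iter-mono : ∀ k {w v} → w ≼ v → iter S k w ≼ iter S k v
  iter-mono zero     w≼v = w≼v
  iter-mono (sucℕ k) w≼v = S-mono (iter-mono k w≼v)

  persistence : ∀ φ {w v} → w ≼ v → _⊨_ M w φ → _⊨_ M v φ
  persistence (var p)  w≼v (lift x)  = lift (V-mono w≼v p x)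
  persistence ⊥'       w≼v (lift ())
  persistence (φ ∧' ψ) w≼v (x , y)   = persistence φ w≼v x , persistence ψ w≼v y
  persistence (φ ∨' ψ) w≼v (inj₁ x)  = inj₁ (persistence φ w≼v x)
  persistence (φ ∨' ψ) w≼v (inj₂ y)  = inj₂ (persistence ψ w≼v y)
  persistence (φ ⇒' ψ) w≼v h u v≼u   = h u (≼-trans w≼v v≼u)
  persistence (◯ φ)    w≼v h         = persistence φ (S-mono w≼v) h
  persistence (□ φ)    w≼v h k       = persistence φ (iter-mono k w≼v) (h k)

module Agreement {a₁ ℓ₁ a₂ ℓ₂ : Level} (M₁ : Model a₁ ℓ₁) (M₂ : Model a₂ ℓ₂) where

  Agree : Form → Model.W M₁ → Model.W M₂ → Set (a₁ ⊔ ℓ₁ ⊔ a₂ ⊔ ℓ₂)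
  Agree φ w₁ w₂ = (_⊨_ M₁ w₁ φ → _⊨_ M₂ w₂ φ) × (_⊨_ M₂ w₂ φ → _⊨_ M₁ w₁ φ)

  agree-∧ : ∀ φ ψ {w₁ w₂} → Agree φ w₁ w₂ → Agree ψ w₁ w₂ → Agree (φ ∧' ψ) w₁ w₂
  agree-∧ _ _ (φ→ , φ←) (ψ→ , ψ←) =
    (λ { (x , y) → φ→ x , ψ→ y }) , (λ { (x , y) → φ← x , ψ← y })

  agree-∨ : ∀ φ ψ {w₁ w₂} → Agree φ w₁ w₂ → Agree ψ w₁ w₂ → Agree (φ ∨' ψ) w₁ w₂
  agree-∨ _ _ (φ→ , φ←) (ψ→ , ψ←) =
    (λ { (inj₁ x) → inj₁ (φ→ x) ; (inj₂ y) → inj₂ (ψ→ y) })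
    , (λ { (inj₁ x) → inj₁ (φ← x) ; (inj₂ y) → inj₂ (ψ← y) })

left-bound : ∀ φ ψ {i} → len φ +ℕ len ψ ≤ i → len φ ≤ i
left-bound φ ψ = ≤-trans (m≤m+n (len φ) (len ψ))

right-bound : ∀ φ ψ {i} → len φ +ℕ len ψ ≤ i → len ψ ≤ i
right-bound φ ψ = ≤-trans (m≤n+m (len ψ) (len φ))

module Invariance {a₁ ℓ₁ a₂ ℓ₂ z : Level} (M₁ : Model a₁ ℓ₁) (M₂ : Model a₂ ℓ₂)
    (n : ℕ) (Z : ℕ → Model.W M₁ → Model.W M₂ → Set z)
    (B : IsBoundedBoxBisim M₁ M₂ n Z) where
  open IsBoundedBoxBisim B
  open Agreement M₁ M₂
  open Persistence M₁ using () renaming (persistence to persistence₁)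
  open Persistence M₂ using () renaming (persistence to persistence₂)

  Invariant : ℕ → Form → Set (a₁ ⊔ ℓ₁ ⊔ a₂ ⊔ ℓ₂ ⊔ z)
  Invariant i φ = ∀ {w₁ w₂} → Z i w₁ w₂ → Agree φ w₁ w₂

  to-Z₀ : ∀ i → i ≤ n → ∀ {w₁ w₂} → Z i w₁ w₂ → Z 0 w₁ w₂
  to-Z₀ zero     _   zᵢ = zᵢ
  to-Z₀ (sucℕ i) i<n zᵢ = to-Z₀ i (<⇒≤ i<n) (nested i i<n zᵢ)

  var-invariant : ∀ {i} p → i ≤ n → Invariant i (var p)
  var-invariant {i} p i≤n zᵢ =
    let (p→ , p←) = atoms 0 n-pos (to-Z₀ i i≤n zᵢ) p
    in (λ x → lift (p→ (lower x))) , (λ x → lift (p← (lower x)))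

  ⊥-invariant : ∀ {i} → Invariant i ⊥'
  ⊥-invariant _ = (λ { (lift ()) }) , (λ { (lift ()) })

  ⇒-invariant : ∀ {j} φ ψ → j < n → Invariant j φ → Invariant j ψ →
                Invariant (sucℕ j) (φ ⇒' ψ)
  ⇒-invariant {j} _ _ j<n inv-φ inv-ψ z =
      (λ h v₂ w₂≼v₂ x →
        let (v₁ , w₁≼v₁ , zv) = back≼ j j<n z v₂ w₂≼v₂
        in proj₁ (inv-ψ zv) (h v₁ w₁≼v₁ (proj₂ (inv-φ zv) x)))
    , (λ h v₁ w₁≼v₁ x →
        let (v₂ , w₂≼v₂ , zv) = forth≼ j j<n z v₁ w₁≼v₁
        in proj₂ (inv-ψ zv) (h v₂ w₂≼v₂ (proj₁ (inv-φ zv) x)))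

  ◯-invariant : ∀ {j} φ → j < n → Invariant j φ → Invariant (sucℕ j) (◯ φ)
  ◯-invariant {j} _ j<n inv-φ z = inv-φ (succ j j<n z)

  -- □ quantifies over all iterates; the □-clauses only give related worlds
  -- sandwiched between iterates, which persistence bridges.
  □-invariant : ∀ {j} φ → j < n → Invariant j φ → Invariant (sucℕ j) (□ φ)
  □-invariant {j} φ j<n inv-φ z =
      (λ h k₂ →
        let (k₁ , v₁ , v₂ , v₂≼S₂ᵏw₂ , S₁ᵏw₁≼v₁ , zv) = forth□ j j<n z k₂
        in persistence₂ φ v₂≼S₂ᵏw₂ (proj₁ (inv-φ zv) (persistence₁ φ S₁ᵏw₁≼v₁ (h k₁))))
    , (λ h k₁ →
        let (k₂ , v₁ , v₂ , v₁≼S₁ᵏw₁ , S₂ᵏw₂≼v₂ , zv) = back□ j j<n z k₁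
        in persistence₁ φ v₁≼S₁ᵏw₁ (proj₂ (inv-φ zv) (persistence₂ φ S₂ᵏw₂≼v₂ (h k₂))))

  invariant : ∀ φ i → i ≤ n → len φ ≤ i → Invariant i φ
  invariant (var p)  i i≤n _ = var-invariant p i≤n
  invariant ⊥'       i i≤n _ = ⊥-invariant
  invariant (φ ∧' ψ) i i≤n l zᵢ =
    agree-∧ φ ψ (invariant φ i i≤n (left-bound φ ψ (<⇒≤ l)) zᵢ)
                (invariant ψ i i≤n (right-bound φ ψ (<⇒≤ l)) zᵢ)
  invariant (φ ∨' ψ) i i≤n l zᵢ =
    agree-∨ φ ψ (invariant φ i i≤n (left-bound φ ψ (<⇒≤ l)) zᵢ)
                (invariant ψ i i≤n (right-bound φ ψ (<⇒≤ l)) zᵢ)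
  invariant (φ ⇒' ψ) (sucℕ j) j<n (s≤s l) =
    ⇒-invariant φ ψ j<n (invariant φ j (<⇒≤ j<n) (left-bound φ ψ l))
                        (invariant ψ j (<⇒≤ j<n) (right-bound φ ψ l))
  invariant (◯ φ) (sucℕ j) j<n (s≤s l) = ◯-invariant φ j<n (invariant φ j (<⇒≤ j<n) l)
  invariant (□ φ) (sucℕ j) j<n (s≤s l) = □-invariant φ j<n (invariant φ j (<⇒≤ j<n) l)

mainTheorem13 : ∀ {a₁ ℓ₁ a₂ ℓ₂ z : Level} (M₁ : Model a₁ ℓ₁) (M₂ : Model a₂ ℓ₂)
    (n : ℕ) (Z : ℕ → Model.W M₁ → Model.W M₂ → Set z) →
    IsBoundedBoxBisim M₁ M₂ n Z →
    ∀ (w₁ : Model.W M₁) (w₂ : Model.W M₂) (i : ℕ) → i ≤ n → Z i w₁ w₂ →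
    ∀ (φ : Form) → len φ ≤ i →
    ((_⊨_ M₁ w₁ φ → _⊨_ M₂ w₂ φ) × (_⊨_ M₂ w₂ φ → _⊨_ M₁ w₁ φ))
mainTheorem13 M₁ M₂ n Z B w₁ w₂ i i≤n zᵢ φ l = Invariance.invariant M₁ M₂ n Z B φ i i≤n l zᵢ
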